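{- Let $\bm{A}\in\mathbb{Z}^{n\times n}$ be a nonsingular matrix with $n\ge|\det\bm{A}|$. Then the parallelepiped $P_{\bm{1}}(\bm{A})=\{\bm{x}\in\mathbb{R}^n:\bm{0}\le\bm{A}\bm{x}\le\bm{1}\}$ contains a non-zero integer vector.
   Context: $\bm{1}$ denotes the all-ones vector and inequalities are componentwise. -}

module Defs where

open import Data.Nat using (ℕ; zero; suc)
open import Data.Integer using (ℤ; +_; _+_; _*_; -_)
open import Data.Fin using (Fin; zero; suc; punchIn)

Vecℤ : ℕ → Set
Vecℤ n = Fin n → ℤ

Matℤ : ℕ → Set
Matℤ n = Fin n → Fin n → ℤ

∑ : (n : ℕ) → (Fin n → ℤ) → ℤ
∑ zero    f = + 0
∑ (suc n) f = f zero + ∑ n (λ i → f (suc i))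

sgn : ℕ → ℤ
sgn zero          = + 1
sgn (suc zero)    = - (+ 1)
sgn (suc (suc k)) = sgn k

minor : {n : ℕ} → Matℤ (suc n) → Fin (suc n) → Matℤ n
minor A j r c = A (suc r) (punchIn j c)

det : (n : ℕ) → Matℤ n → ℤ
det zero    A = + 1
det (suc n) A = ∑ (suc n) (λ j → sgn (Data.Fin.toℕ j) * (A zero j * det n (minor A j)))

_·_ : {n : ℕ} → Matℤ n → Vecℤ n → Vecℤ n
_·_ {n} A x i = ∑ n (λ j → A i j * x j)

-- The column lattice A ℤⁿ has index at most |det A| in ℤⁿ. Adding a multiple of a column to an
-- adjacent one preserves both det A and A ℤⁿ; with such moves a Euclidean algorithm clears the
-- first row to (g, 0, …, 0), after which the class of u modulo A ℤⁿ is determined by u₀ mod g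
-- together with a class for the minor, so there are at most |g| · |det minor| = |det A| classes.
-- Hence two of the n + 1 staircase vectors (1, …, 1, 0, …, 0) differ by some A z, and their
-- difference is a non-zero 0/1 vector.
module Submission where

open import Defs
open import Data.Nat using (ℕ; zero; suc; s≤s; z≤n; _<_)
import Data.Nat.Properties as ℕₚ
open import Data.Nat.Induction using (<-wellFounded)
open import Data.Integer using (ℤ; +_; ∣_∣; _≤_; 0ℤ; 1ℤ; -1ℤ; -_; _+_; _*_; _-_; NonZero; ≢-nonZero; +≤+; _≟_)
import Data.Integer.Properties as ℤₚ
open import Data.Integer.DivMod using (_/_; _%_; a≡a%n+[a/n]*n; n%d<d)
open import Data.Integer.Tactic.RingSolver using (solve-∀)
open import Data.Fin as Fin using (Fin; zero; suc; toℕ; punchIn; punchOut; inject₁; fromℕ; fromℕ<; combine)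
open import Data.Fin.Properties using (suc-injective; toℕ-injective; punchInᵢ≢i; punchIn-punchOut; punchIn-injective; toℕ-inject₁; ≤fromℕ; fromℕ<-injective; combine-injective; pigeonhole)
open import Data.Fin.Induction using (>-weakInduction)
open import Data.Vec.Functional using (updateAt; _∷_)
open import Data.Vec.Functional.Properties using (updateAt-updates; updateAt-minimal; updateAt-id-local)
open import Data.Product using (Σ; _×_; _,_)
open import Data.Sum using (_⊎_; inj₁; inj₂; swap)
open import Function using (_∘_; const)
open import Induction.WellFounded using (Acc; acc)
open import Relation.Binary.PropositionalEquality using (_≡_; _≢_; _≗_; refl; sym; trans; cong; cong₂; subst; module ≡-Reasoning)
open import Relation.Nullary using (¬_; yes; no; contradiction)

open ≡-Reasoning

∑-cong : ∀ n {f g : Fin n → ℤ} → f ≗ g → ∑ n f ≡ ∑ n g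
∑-cong zero    f≗g = refl
∑-cong (suc n) f≗g = cong₂ _+_ (f≗g zero) (∑-cong n (f≗g ∘ suc))

∑-zero : ∀ n {f : Fin n → ℤ} → (∀ i → f i ≡ 0ℤ) → ∑ n f ≡ 0ℤ
∑-zero zero    f≡0 = refl
∑-zero (suc n) f≡0 = cong₂ _+_ (f≡0 zero) (∑-zero n (f≡0 ∘ suc))

∑-linear : ∀ n (f g : Fin n → ℤ) c → ∑ n (λ i → f i + c * g i) ≡ ∑ n f + c * ∑ n g
∑-linear zero    f g c = sym (trans (ℤₚ.+-identityˡ (c * 0ℤ)) (ℤₚ.*-zeroʳ c))
∑-linear (suc n) f g c = trans (cong (_+_ (f zero + c * g zero)) (∑-linear n (f ∘ suc) (g ∘ suc) c))
                               (ring (f zero) (g zero) (∑ n (f ∘ suc)) (∑ n (g ∘ suc)) c)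
  where
  ring : ∀ a b s t c → a + c * b + (s + c * t) ≡ a + s + c * (b + t)
  ring = solve-∀

∑-perturb : ∀ n {f g : Fin n → ℤ} j d → g j ≡ f j + d → (∀ i → i ≢ j → g i ≡ f i) → ∑ n g ≡ ∑ n f + d
∑-perturb (suc n) {f} zero d gj others =
  trans (cong₂ _+_ gj (∑-cong n (λ i → others (suc i) λ ()))) (ring (f zero) d (∑ n (f ∘ suc)))
  where
  ring : ∀ a d s → a + d + s ≡ a + s + d
  ring = solve-∀
∑-perturb (suc n) {f} (suc j) d gj others =
  trans (cong₂ _+_ (others zero λ ()) (∑-perturb n j d gj (λ i i≢j → others (suc i) (i≢j ∘ suc-injective))))
        (sym (ℤₚ.+-assoc (f zero) _ d))

∑-single : ∀ n {f : Fin n → ℤ} j → (∀ i → i ≢ j → f i ≡ 0ℤ) → ∑ n f ≡ f j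
∑-single n {f} j others = begin
  ∑ n f                  ≡⟨ ∑-perturb n {const 0ℤ} j (f j) (sym (ℤₚ.+-identityˡ (f j))) others ⟩
  ∑ n (const 0ℤ) + f j   ≡⟨ cong (_+ f j) (∑-zero n (λ _ → refl)) ⟩
  0ℤ + f j               ≡⟨ ℤₚ.+-identityˡ (f j) ⟩
  f j                    ∎

∑-pair : ∀ n {f : Fin n → ℤ} {a b} → a ≢ b → (∀ i → i ≢ a → i ≢ b → f i ≡ 0ℤ) → ∑ n f ≡ f a + f b
∑-pair (suc n)     {a = zero}  {zero}  a≢b others = contradiction refl a≢b
∑-pair (suc n) {f} {a = zero}  {suc b} a≢b others =
  cong (_+_ (f zero)) (∑-single n b (λ i i≢b → others (suc i) (λ ()) (i≢b ∘ suc-injective)))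
∑-pair (suc n) {f} {a = suc a} {zero}  a≢b others =
  trans (cong (_+_ (f zero)) (∑-single n a (λ i i≢a → others (suc i) (i≢a ∘ suc-injective) (λ ()))))
        (ℤₚ.+-comm (f zero) (f (suc a)))
∑-pair (suc n) {f} {a = suc a} {suc b} a≢b others =
  trans (cong₂ _+_ (others zero (λ ()) (λ ())) (∑-pair n (a≢b ∘ cong suc) λ i i≢a i≢b →
          others (suc i) (i≢a ∘ suc-injective) (i≢b ∘ suc-injective)))
        (ℤₚ.+-identityˡ (f (suc a) + f (suc b)))

setColumn : ∀ {n} → Matℤ n → Fin n → Vecℤ n → Matℤ n
setColumn A j v r = updateAt (A r) j (const (v r))

addColumn : ∀ {n} → Matℤ n → Fin n → Fin n → ℤ → Matℤ n
addColumn A j k c = setColumn A j (λ r → A r j + c * A r k)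

Adjacent : ∀ {n} → Fin n → Fin n → Set
Adjacent a b = toℕ b ≡ suc (toℕ a)

Neighbours : ∀ {n} → Fin n → Fin n → Set
Neighbours a b = Adjacent a b ⊎ Adjacent b a

inject₁-adjacent : ∀ {n} (i : Fin n) → Adjacent (inject₁ i) (suc i)
inject₁-adjacent i = cong suc (sym (toℕ-inject₁ i))

Neighbours⇒≢ : ∀ {n} {a b : Fin n} → Neighbours a b → a ≢ b
Neighbours⇒≢ (inj₁ adj) refl = ℕₚ.1+n≢n (sym adj)
Neighbours⇒≢ (inj₂ adj) refl = ℕₚ.1+n≢n (sym adj)

punchIn-adjacent : ∀ {n} {A : Set} (x : Fin (suc n) → A) {a b} → Adjacent a b → x a ≡ x b →
                   ∀ c → x (punchIn b c) ≡ x (punchIn a c)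
punchIn-adjacent x {zero}  {suc zero}     _   xa≡xb zero    = xa≡xb
punchIn-adjacent x {zero}  {suc zero}     _   xa≡xb (suc c) = refl
punchIn-adjacent x {zero}  {suc (suc b)}  ()
punchIn-adjacent x {suc a} {suc b}        _   xa≡xb zero    = refl
punchIn-adjacent x {suc a} {suc b}        adj xa≡xb (suc c) =
  punchIn-adjacent (x ∘ suc) (ℕₚ.suc-injective adj) xa≡xb c

punchOut-adjacent : ∀ {n} {l a b : Fin (suc n)} (l≢a : l ≢ a) (l≢b : l ≢ b) →
                    Adjacent a b → Adjacent (punchOut l≢a) (punchOut l≢b)
punchOut-adjacent {_}     {zero}        {zero}  l≢a _ _ = contradiction refl l≢a
punchOut-adjacent {_}     {zero}        {suc a} {suc b} _ _ adj = ℕₚ.suc-injective adj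
punchOut-adjacent {suc n} {suc zero}    {zero}  {suc zero} _ l≢b _ = contradiction refl l≢b
punchOut-adjacent {suc (suc n)} {suc (suc l)} {zero} {suc zero} _ _ _ = refl
punchOut-adjacent {suc n} {suc l}       {zero}  {suc (suc b)} _ _ ()
punchOut-adjacent {suc n} {suc l}       {suc a} {suc b} l≢a l≢b adj =
  cong suc (punchOut-adjacent (l≢a ∘ cong suc) (l≢b ∘ cong suc) (ℕₚ.suc-injective adj))

updateAt-punchIn : ∀ {n} {A : Set} (xs : Fin (suc n) → A) {l j} (l≢j : l ≢ j) (f : A → A) c →
                   updateAt xs j f (punchIn l c) ≡ updateAt (xs ∘ punchIn l) (punchOut l≢j) f c
updateAt-punchIn xs {l} {j} l≢j f c with punchOut l≢j Fin.≟ c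
... | yes refl = begin
  updateAt xs j f (punchIn l (punchOut l≢j))  ≡⟨ cong (updateAt xs j f) (punchIn-punchOut l≢j) ⟩
  updateAt xs j f j                           ≡⟨ updateAt-updates j xs ⟩
  f (xs j)                                    ≡⟨ cong (f ∘ xs) (punchIn-punchOut l≢j) ⟨
  f (xs (punchIn l (punchOut l≢j)))           ≡⟨ updateAt-updates (punchOut l≢j) (xs ∘ punchIn l) ⟨
  updateAt (xs ∘ punchIn l) (punchOut l≢j) f (punchOut l≢j) ∎
... | no pl≢c = trans (updateAt-minimal (punchIn l c) j xs punchIn≢j) (sym (updateAt-minimal c _ (xs ∘ punchIn l) (pl≢c ∘ sym)))
  where
  punchIn≢j : punchIn l c ≢ j
  punchIn≢j e = pl≢c (punchIn-injective l _ _ (trans (punchIn-punchOut l≢j) (sym e)))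

sgn-suc : ∀ k → sgn (suc k) ≡ - sgn k
sgn-suc zero          = refl
sgn-suc (suc zero)    = refl
sgn-suc (suc (suc k)) = sgn-suc k

laplaceTerm : ∀ {n} → Matℤ (suc n) → Fin (suc n) → ℤ
laplaceTerm {n} A l = sgn (toℕ l) * (A zero l * det n (minor A l))

det-cong : ∀ n {A B : Matℤ n} → (∀ r c → A r c ≡ B r c) → det n A ≡ det n B
det-cong zero    A≡B = refl
det-cong (suc n) A≡B = ∑-cong (suc n) λ l →
  cong (sgn (toℕ l) *_) (cong₂ _*_ (A≡B zero l) (det-cong n (λ r c → A≡B (suc r) (punchIn l c))))

det-setColumn-linear : ∀ n (A : Matℤ n) j (u v : Vecℤ n) c →
  det n (setColumn A j (λ r → u r + c * v r)) ≡ det n (setColumn A j u) + c * det n (setColumn A j v)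
det-setColumn-linear (suc n) A j u v c =
  trans (∑-cong (suc n) term) (∑-linear (suc n) (laplaceTerm (setColumn A j u)) (laplaceTerm (setColumn A j v)) c)
  where
  w : Vecℤ (suc n)
  w r = u r + c * v r

  termⱼ : ∀ x → laplaceTerm (setColumn A j x) j ≡ sgn (toℕ j) * (x zero * det n (minor A j))
  termⱼ x = cong (sgn (toℕ j) *_) (cong₂ _*_ (updateAt-updates j (A zero))
                 (det-cong n λ r c → updateAt-minimal (punchIn j c) j (A (suc r)) (punchInᵢ≢i j c)))

  termₗ : ∀ {l} (l≢j : l ≢ j) x →
          laplaceTerm (setColumn A j x) l ≡ sgn (toℕ l) * (A zero l * det n (setColumn (minor A l) (punchOut l≢j) (x ∘ suc)))
  termₗ {l} l≢j x = cong (sgn (toℕ l) *_) (cong₂ _*_ (updateAt-minimal l j (A zero) l≢j)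
                        (det-cong n λ r → updateAt-punchIn (A (suc r)) l≢j _))

  term : ∀ l → laplaceTerm (setColumn A j w) l ≡ laplaceTerm (setColumn A j u) l + c * laplaceTerm (setColumn A j v) l
  term l with l Fin.≟ j
  ... | yes refl = begin
    laplaceTerm (setColumn A j w) j                              ≡⟨ termⱼ w ⟩
    s * ((u zero + c * v zero) * d)                              ≡⟨ ring s (u zero) (v zero) c d ⟩
    s * (u zero * d) + c * (s * (v zero * d))                    ≡⟨ cong₂ (λ x y → x + c * y) (termⱼ u) (termⱼ v) ⟨
    laplaceTerm (setColumn A j u) j + c * laplaceTerm (setColumn A j v) j ∎
    where
    s d : ℤ
    s = sgn (toℕ j)
    d = det n (minor A j)
    ring : ∀ s a b c d → s * ((a + c * b) * d) ≡ s * (a * d) + c * (s * (b * d))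
    ring = solve-∀
  ... | no l≢j = begin
    laplaceTerm (setColumn A j w) l                              ≡⟨ termₗ l≢j w ⟩
    s * (a * det n (setColumn M j′ (w ∘ suc)))                   ≡⟨ cong (λ d → s * (a * d)) (det-setColumn-linear n M j′ (u ∘ suc) (v ∘ suc) c) ⟩
    s * (a * (det n (setColumn M j′ (u ∘ suc)) + c * det n (setColumn M j′ (v ∘ suc))))
                                                                 ≡⟨ ring s a _ _ c ⟩
    s * (a * det n (setColumn M j′ (u ∘ suc))) + c * (s * (a * det n (setColumn M j′ (v ∘ suc))))
                                                                 ≡⟨ cong₂ (λ x y → x + c * y) (termₗ l≢j u) (termₗ l≢j v) ⟨
    laplaceTerm (setColumn A j u) l + c * laplaceTerm (setColumn A j v) l ∎
    where
    s a : ℤ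
    s = sgn (toℕ l)
    a = A zero l
    M : Matℤ n
    M = minor A l
    j′ : Fin n
    j′ = punchOut l≢j
    ring : ∀ s a x y c → s * (a * (x + c * y)) ≡ s * (a * x) + c * (s * (a * y))
    ring = solve-∀

-- The terms at a and b share their minor and have opposite signs; every other minor again has
-- two equal adjacent columns.
det-equalAdjacentColumns : ∀ n (A : Matℤ n) {a b} → Adjacent a b → (∀ r → A r a ≡ A r b) → det n A ≡ 0ℤ
det-equalAdjacentColumns (suc n) A {a} {b} adj cols = begin
  ∑ (suc n) (laplaceTerm A)            ≡⟨ ∑-pair (suc n) (Neighbours⇒≢ (inj₁ adj)) others ⟩
  laplaceTerm A a + laplaceTerm A b    ≡⟨ cong (_+_ (laplaceTerm A a)) termᵇ ⟩
  laplaceTerm A a - laplaceTerm A a    ≡⟨ ℤₚ.+-inverseʳ (laplaceTerm A a) ⟩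
  0ℤ                                   ∎
  where
  others : ∀ l → l ≢ a → l ≢ b → laplaceTerm A l ≡ 0ℤ
  others l l≢a l≢b = begin
    sgn (toℕ l) * (A zero l * det n (minor A l)) ≡⟨ cong (λ d → sgn (toℕ l) * (A zero l * d)) minor≡0 ⟩
    sgn (toℕ l) * (A zero l * 0ℤ)                ≡⟨ ring (sgn (toℕ l)) (A zero l) ⟩
    0ℤ                                           ∎
    where
    minor≡0 : det n (minor A l) ≡ 0ℤ
    minor≡0 = det-equalAdjacentColumns n (minor A l) (punchOut-adjacent l≢a l≢b adj) λ r →
      trans (cong (A (suc r)) (punchIn-punchOut l≢a)) (trans (cols (suc r)) (cong (A (suc r)) (sym (punchIn-punchOut l≢b))))
    ring : ∀ s a → s * (a * 0ℤ) ≡ 0ℤ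
    ring = solve-∀
  termᵇ : laplaceTerm A b ≡ - laplaceTerm A a
  termᵇ = begin
    sgn (toℕ b) * (A zero b * det n (minor A b))   ≡⟨ cong₂ _*_ (trans (cong sgn adj) (sgn-suc (toℕ a)))
                                                        (cong₂ _*_ (sym (cols zero)) (det-cong n λ r → punchIn-adjacent (A (suc r)) adj (cols (suc r)))) ⟩
    - sgn (toℕ a) * (A zero a * det n (minor A a)) ≡⟨ ℤₚ.neg-distribˡ-* (sgn (toℕ a)) _ ⟨
    - laplaceTerm A a                              ∎

det-addColumn : ∀ n (A : Matℤ n) {j k} c → Neighbours j k → det n (addColumn A j k c) ≡ det n A
det-addColumn n A {j} {k} c jk = begin
  det n (addColumn A j k c)                           ≡⟨ det-setColumn-linear n A j (λ r → A r j) (λ r → A r k) c ⟩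
  det n (setColumn A j (λ r → A r j)) + c * det n B   ≡⟨ cong₂ (λ x y → x + c * y) (det-cong n λ r → updateAt-id-local j (A r) refl) (B-singular jk) ⟩
  det n A + c * 0ℤ                                    ≡⟨ ring (det n A) c ⟩
  det n A                                             ∎
  where
  B : Matℤ n
  B = setColumn A j (λ r → A r k)
  cols : ∀ r → B r j ≡ B r k
  cols r = trans (updateAt-updates j (A r)) (sym (updateAt-minimal k j (A r) (Neighbours⇒≢ jk ∘ sym)))
  B-singular : Neighbours j k → det n B ≡ 0ℤ
  B-singular (inj₁ adj) = det-equalAdjacentColumns n B adj cols
  B-singular (inj₂ adj) = det-equalAdjacentColumns n B adj (sym ∘ cols)
  ring : ∀ x c → x + c * 0ℤ ≡ x
  ring = solve-∀

det-firstRowSupportedAtZero : ∀ n (A : Matℤ (suc n)) → (∀ l → A zero (suc l) ≡ 0ℤ) →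
                              det (suc n) A ≡ A zero zero * det n (minor A zero)
det-firstRowSupportedAtZero n A row = trans (∑-single (suc n) zero others) (ℤₚ.*-identityˡ _)
  where
  others : ∀ l → l ≢ zero → laplaceTerm A l ≡ 0ℤ
  others zero    0≢0 = contradiction refl 0≢0
  others (suc l) _   = trans (cong (λ x → sgn (toℕ (suc l)) * (x * det n (minor A (suc l)))) (row l))
                             (ring (sgn (toℕ (suc l))) (det n (minor A (suc l))))
    where
    ring : ∀ s d → s * (0ℤ * d) ≡ 0ℤ
    ring = solve-∀

·-zeroʳ : ∀ {n} (A : Matℤ n) {z : Vecℤ n} → (∀ i → z i ≡ 0ℤ) → ∀ r → (A · z) r ≡ 0ℤ
·-zeroʳ {n} A z≡0 r = ∑-zero n λ l → trans (cong (A r l *_) (z≡0 l)) (ℤₚ.*-zeroʳ (A r l))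

InLattice : ∀ {n} → Matℤ n → Vecℤ n → Set
InLattice {n} A v = Σ (Vecℤ n) λ z → ∀ r → v r ≡ (A · z) r

record _↝_ {n} (A B : Matℤ n) : Set where
  field
    det-≡    : det n B ≡ det n A
    columns∈ : ∀ w → InLattice A (B · w)

open _↝_

↝-refl : ∀ {n} {A : Matℤ n} → A ↝ A
↝-refl = record { det-≡ = refl ; columns∈ = λ w → w , λ _ → refl }

↝-lattice : ∀ {n} {A B : Matℤ n} → A ↝ B → ∀ {v} → InLattice B v → InLattice A v
↝-lattice A↝B (w , v≡Bw) = let z , Bw≡Az = columns∈ A↝B w in z , λ r → trans (v≡Bw r) (Bw≡Az r)

↝-trans : ∀ {n} {A B C : Matℤ n} → A ↝ B → B ↝ C → A ↝ C
↝-trans A↝B B↝C = record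
  { det-≡    = trans (det-≡ B↝C) (det-≡ A↝B)
  ; columns∈ = λ w → ↝-lattice A↝B (columns∈ B↝C w)
  }

addColumn-↝ : ∀ {n} (A : Matℤ n) {j k} c → Neighbours j k → A ↝ addColumn A j k c
addColumn-↝ {n} A {j} {k} c jk = record
  { det-≡    = det-addColumn n A c jk
  ; columns∈ = λ w → updateAt w k (λ t → t + c * w j) , λ r → trans (perturbed-column w r) (sym (perturbed-vector w r))
  }
  where
  perturbed-column : ∀ w r → (addColumn A j k c · w) r ≡ (A · w) r + c * A r k * w j
  perturbed-column w r = ∑-perturb n j _
    (trans (cong (_* w j) (updateAt-updates j (A r))) (ring (A r j) (A r k) c (w j)))
    (λ l l≢j → cong (_* w l) (updateAt-minimal l j (A r) l≢j))
    where
    ring : ∀ a b c x → (a + c * b) * x ≡ a * x + c * b * x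
    ring = solve-∀
  perturbed-vector : ∀ w r → (A · updateAt w k (λ t → t + c * w j)) r ≡ (A · w) r + c * A r k * w j
  perturbed-vector w r = ∑-perturb n k _
    (trans (cong (A r k *_) (updateAt-updates k w)) (ring (A r k) (w k) c (w j)))
    (λ l l≢k → cong (A r l *_) (updateAt-minimal l k w l≢k))
    where
    ring : ∀ a x c y → a * (x + c * y) ≡ a * x + c * a * y
    ring = solve-∀

-- Three additions send the columns (a, b) to (b, −a); this replaces a column swap.
rotateColumns : ∀ {n} → Matℤ n → Fin n → Fin n → Matℤ n
rotateColumns A a b = addColumn (addColumn (addColumn A a b 1ℤ) b a -1ℤ) a b 1ℤ

rotateColumns-↝ : ∀ {n} (A : Matℤ n) {a b} → Neighbours a b → A ↝ rotateColumns A a b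
rotateColumns-↝ A ab =
  ↝-trans (addColumn-↝ A 1ℤ ab) (↝-trans (addColumn-↝ _ -1ℤ (swap ab)) (addColumn-↝ _ 1ℤ ab))

rotateColumns-second : ∀ {n} (A : Matℤ n) {a b} → Neighbours a b → ∀ r → rotateColumns A a b r b ≡ - A r a
rotateColumns-second A {a} {b} ab r = begin
  rotateColumns A a b r b                   ≡⟨ updateAt-minimal b a _ b≢a ⟩
  addColumn A₁ b a -1ℤ r b                  ≡⟨ updateAt-updates b (A₁ r) ⟩
  A₁ r b + -1ℤ * A₁ r a                     ≡⟨ cong₂ (λ x y → x + -1ℤ * y) (updateAt-minimal b a (A r) b≢a) (updateAt-updates a (A r)) ⟩
  A r b + -1ℤ * (A r a + 1ℤ * A r b)        ≡⟨ ring (A r a) (A r b) ⟩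
  - A r a                                   ∎
  where
  A₁ : Matℤ _
  A₁ = addColumn A a b 1ℤ
  b≢a : b ≢ a
  b≢a = Neighbours⇒≢ ab ∘ sym
  ring : ∀ x y → y + -1ℤ * (x + 1ℤ * y) ≡ - x
  ring = solve-∀

rotateColumns-other : ∀ {n} (A : Matℤ n) {a b} r {l} → l ≢ a → l ≢ b → rotateColumns A a b r l ≡ A r l
rotateColumns-other A r l≢a l≢b =
  trans (updateAt-minimal _ _ _ l≢a) (trans (updateAt-minimal _ _ _ l≢b) (updateAt-minimal _ _ _ l≢a))

-- Each round subtracts (x / y) · column b from column a and rotates, so the entry y at b is
-- replaced by −(x mod y), which is smaller in absolute value.
clearEntry : ∀ {n} (A : Matℤ n) r {a b} → Neighbours a b → Acc _<_ ∣ A r b ∣ →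
             Σ (Matℤ n) λ B → A ↝ B × B r b ≡ 0ℤ × (∀ s {l} → l ≢ a → l ≢ b → B s l ≡ A s l)
clearEntry A r {a} {b} ab (acc smaller) with A r b ≟ 0ℤ
... | yes y≡0 = A , ↝-refl , y≡0 , λ _ _ _ → refl
... | no  y≢0 =
  let C , B↝C , Crb≡0 , C-other = clearEntry B r ab (smaller ∣Brb∣<∣y∣)
  in  C , ↝-trans A↝B B↝C , Crb≡0 , λ s l≢a l≢b → trans (C-other s l≢a l≢b) (B-other s l≢a l≢b)
  where
  x y q : ℤ
  x = A r a
  y = A r b
  instance
    y-nonZero : NonZero y
    y-nonZero = ≢-nonZero y≢0
  q = x / y
  A′ B : Matℤ _
  A′ = addColumn A a b (- q)
  B = rotateColumns A′ a b
  A↝B : A ↝ B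
  A↝B = ↝-trans (addColumn-↝ A (- q) ab) (rotateColumns-↝ A′ ab)
  Brb≡-rem : B r b ≡ - + (x % y)
  Brb≡-rem = begin
    B r b                              ≡⟨ rotateColumns-second A′ ab r ⟩
    - A′ r a                           ≡⟨ cong -_ (updateAt-updates a (A r)) ⟩
    - (x + - q * y)                    ≡⟨ cong (λ t → - (t + - q * y)) (a≡a%n+[a/n]*n x y) ⟩
    - (+ (x % y) + q * y + - q * y)    ≡⟨ ring (+ (x % y)) q y ⟩
    - + (x % y)                        ∎
    where
    ring : ∀ m q y → - (m + q * y + - q * y) ≡ - m
    ring = solve-∀
  ∣Brb∣<∣y∣ : ∣ B r b ∣ < ∣ y ∣
  ∣Brb∣<∣y∣ = subst (_< ∣ y ∣) (sym (trans (cong ∣_∣ Brb≡-rem) (ℤₚ.∣-i∣≡∣i∣ (+ (x % y))))) (n%d<d x y)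
  B-other : ∀ s {l} → l ≢ a → l ≢ b → B s l ≡ A s l
  B-other s l≢a l≢b = trans (rotateColumns-other A′ s l≢a l≢b) (updateAt-minimal _ _ (A s) l≢a)

clearFirstRow : ∀ {n} (A : Matℤ (suc n)) → Σ (Matℤ (suc n)) λ B → A ↝ B × (∀ l → B zero (suc l) ≡ 0ℤ)
clearFirstRow {n} A =
  let B , A↝B , cleared = >-weakInduction ClearedBeyond base step zero
  in  B , A↝B , λ l → cleared (suc l) (s≤s z≤n)
  where
  ClearedBeyond : Fin (suc n) → Set
  ClearedBeyond i = Σ (Matℤ (suc n)) λ B → A ↝ B × (∀ l → i Fin.< l → B zero l ≡ 0ℤ)
  base : ClearedBeyond (fromℕ n)
  base = A , ↝-refl , λ l n<l → contradiction (≤fromℕ l) (ℕₚ.<⇒≱ n<l)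
  step : ∀ i → ClearedBeyond (suc i) → ClearedBeyond (inject₁ i)
  step i (B , A↝B , cleared) with clearEntry B zero (inj₁ (inject₁-adjacent i)) (<-wellFounded _)
  ... | C , B↝C , C₀ᵢ₊₁≡0 , C-other = C , ↝-trans A↝B B↝C , cleared′
    where
    cleared′ : ∀ l → inject₁ i Fin.< l → C zero l ≡ 0ℤ
    cleared′ l i<l with l Fin.≟ suc i
    ... | yes refl   = C₀ᵢ₊₁≡0
    ... | no  l≢i+1 = trans (C-other zero (λ { refl → ℕₚ.<-irrefl refl i<l }) l≢i+1) (cleared l i+1<l)
      where
      i+1<l : suc i Fin.< l
      i+1<l = ℕₚ.≤∧≢⇒< (subst (_< toℕ l) (toℕ-inject₁ i) i<l) (l≢i+1 ∘ toℕ-injective ∘ sym)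

-- ℤⁿ is split into k classes, each inside one coset of A ℤⁿ: the index of A ℤⁿ is at most k.
IndexAtMost : ∀ {n} → Matℤ n → ℕ → Set
IndexAtMost {n} A k = Σ (Vecℤ n → Fin k) λ class → ∀ u v → class u ≡ class v → InLattice A (λ r → v r - u r)

indexAtMost-↝ : ∀ {n} {A B : Matℤ n} {k} → A ↝ B → IndexAtMost B k → IndexAtMost A k
indexAtMost-↝ A↝B (class , sound) = class , λ u v same → ↝-lattice A↝B (sound u v same)

indexAtMost-firstRowSupportedAtZero : ∀ {n} (B : Matℤ (suc n)) {k} → (∀ l → B zero (suc l) ≡ 0ℤ) →
  .{{_ : NonZero (B zero zero)}} → IndexAtMost (minor B zero) k → IndexAtMost B (∣ B zero zero ∣ Data.Nat.* k)
indexAtMost-firstRowSupportedAtZero {n} B {k} row (class , sound) = class′ , sound′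
  where
  g : ℤ
  g = B zero zero
  quotient : Vecℤ (suc n) → ℤ
  quotient u = u zero / g
  reducedTail : Vecℤ (suc n) → Vecℤ n
  reducedTail u s = u (suc s) - quotient u * B (suc s) zero
  class′ : Vecℤ (suc n) → Fin (∣ g ∣ Data.Nat.* k)
  class′ u = combine (fromℕ< (n%d<d (u zero) g)) (class (reducedTail u))

  lift : ∀ u v → u zero % g ≡ v zero % g → InLattice (minor B zero) (λ s → reducedTail v s - reducedTail u s) →
         InLattice B (λ r → v r - u r)
  lift u v rem≡ (z , tail≡) = (quotient v - quotient u) ∷ z , rows
    where
    qu qv : ℤ
    qu = quotient u
    qv = quotient v
    rows : ∀ r → v r - u r ≡ (B · ((qv - qu) ∷ z)) r
    rows zero = begin
      v zero - u zero                                  ≡⟨ cong₂ _-_ (a≡a%n+[a/n]*n (v zero) g)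
                                                          (trans (a≡a%n+[a/n]*n (u zero) g) (cong (λ m → + m + qu * g) rem≡)) ⟩
      (+ (v zero % g) + qv * g) - (+ (v zero % g) + qu * g) ≡⟨ ring (+ (v zero % g)) qu qv g ⟩
      g * (qv - qu) + 0ℤ                               ≡⟨ cong (_+_ (g * (qv - qu))) (∑-zero n λ l → trans (cong (_* z l) (row l)) (ℤₚ.*-zeroˡ (z l))) ⟨
      (B · ((qv - qu) ∷ z)) zero                       ∎
      where
      ring : ∀ m qu qv g → (m + qv * g) - (m + qu * g) ≡ g * (qv - qu) + 0ℤ
      ring = solve-∀
    rows (suc s) = trans (ring (v (suc s)) (u (suc s)) qu qv (B (suc s) zero)) (cong (_+_ (B (suc s) zero * (qv - qu))) (tail≡ s))
      where
      ring : ∀ vs us qu qv t → vs - us ≡ t * (qv - qu) + ((vs - qv * t) - (us - qu * t))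
      ring = solve-∀

  sound′ : ∀ u v → class′ u ≡ class′ v → InLattice B (λ r → v r - u r)
  sound′ u v same =
    let same-rem , same-class = combine-injective (fromℕ< (n%d<d (u zero) g)) (class (reducedTail u))
                                                  (fromℕ< (n%d<d (v zero) g)) (class (reducedTail v)) same
    in  lift u v (fromℕ<-injective _ _ (n%d<d (u zero) g) (n%d<d (v zero) g) same-rem)
                 (sound (reducedTail u) (reducedTail v) same-class)

indexAtMost-det : ∀ n (A : Matℤ n) → det n A ≢ 0ℤ → IndexAtMost A ∣ det n A ∣
indexAtMost-det zero    A _ = (λ _ → zero) , λ u v _ → u , λ ()
indexAtMost-det (suc n) A det≢0 with clearFirstRow A
... | B , A↝B , row = indexAtMost-↝ A↝B (subst (IndexAtMost B) ∣g∣*∣D∣≡∣detA∣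
                        (indexAtMost-firstRowSupportedAtZero B row (indexAtMost-det n M D≢0)))
  where
  M : Matℤ n
  M = minor B zero
  g D : ℤ
  g = B zero zero
  D = det n M
  detB≡g*D : det (suc n) B ≡ g * D
  detB≡g*D = det-firstRowSupportedAtZero n B row
  detB≢0 : det (suc n) B ≢ 0ℤ
  detB≢0 = det≢0 ∘ trans (sym (det-≡ A↝B))
  g≢0 : g ≢ 0ℤ
  g≢0 g≡0 = detB≢0 (trans detB≡g*D (trans (cong (_* D) g≡0) (ℤₚ.*-zeroˡ D)))
  D≢0 : D ≢ 0ℤ
  D≢0 D≡0 = detB≢0 (trans detB≡g*D (trans (cong (g *_) D≡0) (ℤₚ.*-zeroʳ g)))
  instance
    g-nonZero : NonZero g
    g-nonZero = ≢-nonZero g≢0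
  ∣g∣*∣D∣≡∣detA∣ : ∣ g ∣ Data.Nat.* ∣ D ∣ ≡ ∣ det (suc n) A ∣
  ∣g∣*∣D∣≡∣detA∣ = trans (sym (ℤₚ.∣i*j∣≡∣i∣*∣j∣ g D)) (cong ∣_∣ (trans (sym detB≡g*D) (det-≡ A↝B)))

Bit : ℤ → Set
Bit x = + 0 ≤ x × x ≤ + 1

staircase : ∀ {n} → Fin (suc n) → Vecℤ n
staircase zero    r       = 0ℤ
staircase (suc k) zero    = 1ℤ
staircase (suc k) (suc r) = staircase k r

staircase-bit : ∀ {n} (k : Fin (suc n)) r → Bit (staircase k r)
staircase-bit zero    r       = +≤+ z≤n , +≤+ z≤n
staircase-bit (suc k) zero    = +≤+ z≤n , +≤+ (s≤s z≤n)
staircase-bit (suc k) (suc r) = staircase-bit k r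

staircase-diff-bit : ∀ {n} {i j : Fin (suc n)} → i Fin.< j → ∀ r → Bit (staircase j r - staircase i r)
staircase-diff-bit {i = zero}  {j}     _   r       = subst Bit (sym (ℤₚ.+-identityʳ (staircase j r))) (staircase-bit j r)
staircase-diff-bit {i = suc i} {suc j} _   zero    = +≤+ z≤n , +≤+ z≤n
staircase-diff-bit {i = suc i} {suc j} i<j (suc r) = staircase-diff-bit (ℕₚ.≤-pred i<j) r

staircase-diff-nonzero : ∀ {n} {i j : Fin (suc n)} → i Fin.< j → ¬ (∀ r → staircase j r - staircase i r ≡ 0ℤ)
staircase-diff-nonzero {suc n} {zero}  {suc j} _   diff≡0 = contradiction (diff≡0 zero) λ ()
staircase-diff-nonzero {suc n} {suc i} {suc j} i<j diff≡0 = staircase-diff-nonzero (ℕₚ.≤-pred i<j) (diff≡0 ∘ suc)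

lemma3 : (n : ℕ) (A : Matℤ n) → ¬ (det n A ≡ + 0) → ∣ det n A ∣ Data.Nat.≤ n →
    Σ (Vecℤ n) (λ x → ¬ (∀ i → x i ≡ + 0) × (∀ i → (+ 0 ≤ (A · x) i) × ((A · x) i ≤ + 1)))
lemma3 n A det≢0 ∣det∣≤n =
  let class , sound          = indexAtMost-det n A det≢0
      i , j , i<j , same     = pigeonhole (s≤s ∣det∣≤n) (class ∘ staircase)
      z , diff≡Az            = sound (staircase i) (staircase j) same
  in  z , (λ z≡0 → staircase-diff-nonzero i<j λ r → trans (diff≡Az r) (·-zeroʳ A z≡0 r))
        , λ r → subst Bit (diff≡Az r) (staircase-diff-bit i<j r)
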